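{- Let $k \geq 5$ be an integer. Let $H(k)$ be the graph whose vertex set is the disjoint union of four independent sets $A(k), B(k), X(k), Y(k)$ with $|A(k)| = |B(k)| = \lceil k/2 \rceil$ and $|X(k)| = |Y(k)| = \lfloor k/2 \rfloor$, in which every vertex of $A(k)$ is adjacent to every vertex of $B(k) \cup X(k)$, every vertex of $X(k)$ is adjacent to every vertex of $A(k) \cup Y(k)$, and there are no other edges. Let $\alpha_1 \in \{3,5,\dots,2k-3\}$, $\alpha_2 \in \{3,5,\dots,2k-1\}$, $\beta_1 \in \{2,4,\dots,2k-4\}$, and $\beta_2 \in \{2,4,\dots,2k-2\}$. Then for any $a \neq a' \in A(k)$, $b \neq b' \in B(k)$, $x \neq x' \in X(k)$, and $y \neq y' \in Y(k)$, the graph $H(k)$ contains a path of length (i) $\alpha_1$ from $a$ to $x$, from $b$ to $a$, and from $y$ to $x$; (ii) $\alpha_2$ from $b$ to $y$; (iii) $\beta_1$ from $a$ to $a'$, and from $x$ to $x'$; (iv) $\beta_2$ from $b$ to $b'$, from $y$ to $y'$, from $b$ to $x$, and from $y$ to $a$.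
   Context: A path means a simple path (no repeated vertices), and the length of a path is its number of edges. -}

module Defs where

open import Data.Nat using (ℕ; zero; suc; _+_; _*_; _∸_; _≤_; ⌊_/2⌋; ⌈_/2⌉)
open import Data.Fin using (Fin)
open import Data.Vec using (Vec; []; _∷_; head; last; lookup)
open import Data.Product using (∃-syntax; _×_)
open import Data.Empty using (⊥)
open import Data.Unit using (⊤)
open import Relation.Binary.PropositionalEquality using (_≡_)
open import Function.Definitions using (Injective)

data V (k : ℕ) : Set where
  vA : Fin ⌈ k /2⌉ → V k
  vB : Fin ⌈ k /2⌉ → V k
  vX : Fin ⌊ k /2⌋ → V k
  vY : Fin ⌊ k /2⌋ → V k

Adj : ∀ {k} → V k → V k → Set
Adj (vA _) (vB _) = ⊤
Adj (vA _) (vX _) = ⊤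
Adj (vB _) (vA _) = ⊤
Adj (vX _) (vA _) = ⊤
Adj (vX _) (vY _) = ⊤
Adj (vY _) (vX _) = ⊤
Adj _      _      = ⊥

Walk : ∀ {k n} → Vec (V k) n → Set
Walk []               = ⊤
Walk (_ ∷ [])         = ⊤
Walk (u ∷ (v ∷ vs))   = Adj u v × Walk (v ∷ vs)

PathOfLength : ∀ {k} → ℕ → V k → V k → Set
PathOfLength {k} ℓ u v =
  ∃[ p ] (head p ≡ u × last p ≡ v × Walk p × Injective _≡_ _≡_ (lookup {n = suc ℓ} p))

Odd : ℕ → Set
Odd n = ∃[ i ] n ≡ suc (2 * i)

Even : ℕ → Set
Even n = ∃[ i ] n ≡ 2 * i

module Submission where

-- H(k) has four classes on the "class path" B – A – X – Y: the block ab = A ∪ B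
-- (classes of size ⌈k/2⌉) and the block xy = X ∪ Y (classes of size ⌊k/2⌋), and two
-- vertices are adjacent iff their classes are adjacent on the class path.  Hence a
-- word over the classes that walks along the class path and uses each class c at
-- most |c| times is realised by a path: replace the i-th occurrence of c by the
-- i-th vertex of c, after two transpositions making the first and the last vertex
-- the prescribed ones (word-path, built on the occurrence numbering of module
-- Occurrences and the transpositions of module Swap).
--
-- All required paths come from words  s (s̄ s)ᵖ M t (t̄ t)ᵠ S : a zigzag in the block
-- of s (s̄ is the other class of that block), a short connector M, a zigzag in the
-- other block and a short ending S.  zigzag-family shows that the word fits for
-- every budget r = p + q the block sizes allow, giving paths of all lengths
-- 2r + |M| + |S| + 1.  The lemma (which holds for k ≥ 4) picks a base word for each
-- of the ten kinds of endpoints and turns the parity and range hypotheses into such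
-- a budget (within).

open import Defs
open import Data.Nat using (ℕ; zero; suc; _+_; _*_; _∸_; _%_; _≤_; _<_; _⊓_; _⊔_; z≤n; s≤s; NonZero; >-nonZero; ⌊_/2⌋; ⌈_/2⌉)
open import Data.Nat.Properties
open import Data.Nat.DivMod using (_mod_; m<n⇒m%n≡m)
open import Data.Nat.Tactic.RingSolver using (solve-∀)
open import Data.Fin using (Fin; toℕ)
import Data.Fin.Properties as Fin
open import Data.Vec using (Vec; []; _∷_; _++_; head; last; map)
open import Data.Vec.Properties using (map-∘)
open import Data.Vec.Relation.Unary.All as All using (All; []; _∷_)
import Data.Vec.Relation.Unary.All.Properties as All
open import Data.Vec.Relation.Unary.AllPairs as AllPairs using ([]; _∷_)
open import Data.Vec.Relation.Unary.Linked as Linked using (Linked; []; [-]; _∷_)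
import Data.Vec.Relation.Unary.Linked.Properties as Linked
open import Data.Vec.Relation.Unary.Unique.Propositional using (Unique)
import Data.Vec.Relation.Unary.Unique.Propositional.Properties as Unique
open import Data.Product using (Σ; ∃; ∃₂; _×_; _,_; proj₁; proj₂; uncurry)
open import Data.Product.Properties using (≡-dec)
open import Data.Sum using (_⊎_; inj₁; inj₂)
open import Data.Unit using (tt)
open import Relation.Binary.Definitions using (DecidableEquality)
open import Relation.Binary.PropositionalEquality
open import Relation.Nullary using (yes; no; contradiction)
open import Relation.Nullary.Decidable using (map′)

-- Numbering the occurrences of letters in a word

module Occurrences {L : Set} (_≟_ : DecidableEquality L) where

  occ : L → L → ℕ
  occ c x with c ≟ x
  ... | yes _ = 1
  ... | no  _ = 0

  count : ∀ {n} → L → Vec L n → ℕ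
  count c []       = 0
  count c (x ∷ xs) = occ c x + count c xs

  occ-self : ∀ c → occ c c ≡ 1
  occ-self c with c ≟ c
  ... | yes _   = refl
  ... | no  c≢c = contradiction refl c≢c

  count-++ : ∀ {m n} c (xs : Vec L m) (ys : Vec L n) → count c (xs ++ ys) ≡ count c xs + count c ys
  count-++ c []       ys = refl
  count-++ c (x ∷ xs) ys = trans (cong (occ c x +_) (count-++ c xs ys)) (sym (+-assoc (occ c x) _ _))

  count-absent : ∀ {n c} {xs : Vec L n} → All (c ≢_) xs → count c xs ≡ 0
  count-absent [] = refl
  count-absent {c = c} {x ∷ _} (c≢x ∷ rest) with c ≟ x
  ... | yes c≡x = contradiction c≡x c≢x
  ... | no  _   = count-absent rest

  count-pair : ∀ c {x y} → x ≢ y → count c (x ∷ y ∷ []) ≤ 1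
  count-pair c {x} {y} x≢y with c ≟ x | c ≟ y
  ... | yes refl | yes refl = contradiction refl x≢y
  ... | yes _    | no  _    = ≤-refl
  ... | no  _    | yes _    = ≤-refl
  ... | no  _    | no  _    = z≤n

  -- Entry i of  number w  is (wᵢ , number of earlier occurrences of wᵢ).
  -- It is built by prepending (x , 0) and ticking the entries with letter x.
  tick : L → L × ℕ → L × ℕ
  tick x (c , n) = c , occ c x + n

  number : ∀ {n} → Vec L n → Vec (L × ℕ) n
  number []       = []
  number (x ∷ xs) = (x , 0) ∷ map (tick x) (number xs)

  tick-injective : ∀ x {p q} → tick x p ≡ tick x q → p ≡ q
  tick-injective x {c , m} {c′ , n} eq with cong proj₁ eq
  ... | refl = cong (c ,_) (+-cancelˡ-≡ (occ c x) m n (cong proj₂ eq))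

  tick-fresh : ∀ x p → (x , 0) ≢ tick x p
  tick-fresh x (c , n) eq with cong proj₁ eq
  ... | refl = 0≢1+n (trans (cong proj₂ eq) (cong (_+ n) (occ-self x)))

  number-letters : ∀ {n} (w : Vec L n) → map proj₁ (number w) ≡ w
  number-letters []       = refl
  number-letters (x ∷ xs) = cong (x ∷_) (trans (sym (map-∘ proj₁ (tick x) (number xs))) (number-letters xs))

  number-unique : ∀ {n} (w : Vec L n) → Unique (number w)
  number-unique []       = []
  number-unique (x ∷ xs) =
    All.map⁺ (All.universal (tick-fresh x) (number xs)) ∷ Unique.map⁺ (tick-injective x) (number-unique xs)

  number-bound : ∀ {n} (w : Vec L n) → All (λ p → proj₂ p < count (proj₁ p) w) (number w)
  number-bound []       = []
  number-bound (x ∷ xs) = first ∷ All.map⁺ (All.map (λ {p} → +-monoʳ-< (occ (proj₁ p) x)) (number-bound xs))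
    where
    first : 0 < occ x x + count x xs
    first = subst (λ o → 0 < o + count x xs) (sym (occ-self x)) (s≤s z≤n)

-- Transpositions of a type with decidable equality

module Swap {S : Set} (_≟_ : DecidableEquality S) where

  swap : S → S → S → S
  swap a b x with x ≟ a
  ... | yes _ = b
  ... | no  _ with x ≟ b
  ...   | yes _ = a
  ...   | no  _ = x

  swap-left : ∀ a b → swap a b a ≡ b
  swap-left a b with a ≟ a
  ... | yes _   = refl
  ... | no  a≢a = contradiction refl a≢a

  swap-right : ∀ a b → swap a b b ≡ a
  swap-right a b with b ≟ a
  ... | yes b≡a = b≡a
  ... | no  _ with b ≟ b
  ...   | yes _   = refl
  ...   | no  b≢b = contradiction refl b≢b

  swap-other : ∀ {a b x} → x ≢ a → x ≢ b → swap a b x ≡ x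
  swap-other {a} {b} {x} x≢a x≢b with x ≟ a
  ... | yes x≡a = contradiction x≡a x≢a
  ... | no  _ with x ≟ b
  ...   | yes x≡b = contradiction x≡b x≢b
  ...   | no  _   = refl

  swap-involutive : ∀ a b x → swap a b (swap a b x) ≡ x
  swap-involutive a b x with x ≟ a
  ... | yes refl = swap-right x b
  ... | no  x≢a with x ≟ b
  ...   | yes refl = swap-left a x
  ...   | no  x≢b  = swap-other x≢a x≢b

  swap-injective : ∀ a b {x y} → swap a b x ≡ swap a b y → x ≡ y
  swap-injective a b {x} {y} eq =
    trans (sym (swap-involutive a b x)) (trans (cong (swap a b) eq) (swap-involutive a b y))

  swap-preserves : ∀ {T : Set} (f : S → T) {a b} → f a ≡ f b → ∀ x → f (swap a b x) ≡ f x
  swap-preserves f {a} {b} fa≡fb x with x ≟ a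
  ... | yes refl = sym fa≡fb
  ... | no  _ with x ≟ b
  ...   | yes refl = fa≡fb
  ...   | no  _    = refl

last-map : ∀ {A B : Set} (f : A → B) {n} (xs : Vec A (suc n)) → last (map f xs) ≡ f (last xs)
last-map f (x ∷ [])     = refl
last-map f (x ∷ y ∷ xs) = last-map f (y ∷ xs)

last-++ : ∀ {A : Set} {m n} x (xs : Vec A m) (ys : Vec A (suc n)) → last (x ∷ xs ++ ys) ≡ last ys
last-++ x []        (y ∷ ys) = refl
last-++ x (x′ ∷ xs) ys       = last-++ x′ xs ys

All-last : ∀ {A : Set} {P : A → Set} {n} {xs : Vec A (suc n)} → All P xs → P (last xs)
All-last {xs = _ ∷ []}    (px ∷ [])  = px
All-last {xs = _ ∷ _ ∷ _} (_ ∷ pxs) = All-last pxs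

linked-join : ∀ {A : Set} {R : A → A → Set} {m n} (xs : Vec A m) {y} {zs : Vec A n} →
              Linked R (xs ++ y ∷ []) → Linked R (y ∷ zs) → Linked R (xs ++ y ∷ zs)
linked-join []            _          ys = ys
linked-join (x ∷ [])      (r ∷ [-])  ys = r ∷ ys
linked-join (x ∷ x′ ∷ xs) (r ∷ rest) ys = r ∷ linked-join (x′ ∷ xs) rest ys

unique-map-on : ∀ {A B : Set} {P : A → Set} {f : A → B} → (∀ {x y} → P x → P y → f x ≡ f y → x ≡ y) →
                ∀ {n} {xs : Vec A n} → All P xs → Unique xs → Unique (map f xs)
unique-map-on inj []         []         = []
unique-map-on inj (px ∷ pxs) (x∉ ∷ uxs) =
  All.map⁺ (All.map (λ (x≢y , py) fx≡fy → x≢y (inj px py fx≡fy)) (All.zip (x∉ , pxs)))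
  ∷ unique-map-on inj pxs uxs

linked⇒walk : ∀ {k n} {p : Vec (V k) n} → Linked Adj p → Walk p
linked⇒walk []                        = tt
linked⇒walk [-]                       = tt
linked⇒walk {p = _ ∷ _ ∷ _} (e ∷ es) = e , linked⇒walk es

path : ∀ {k ℓ u v} (p : Vec (V k) (suc ℓ)) → head p ≡ u → last p ≡ v → Linked Adj p → Unique p →
       PathOfLength ℓ u v
path p first final linked distinct =
  p , first , final , linked⇒walk linked , λ {i} {j} → Unique.lookup-injective distinct i j

split : ∀ {r a b x y} → a ≤ x → b ≤ y → r + (a + b) ≤ x + y →
        ∃₂ λ p q → p + q ≡ r × p + a ≤ x × q + b ≤ y
split {r} {a} {b} {x} {y} a≤x b≤y budget =
  P ⊓ r , r ∸ P , m⊓n+n∸m≡n P r ,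
  m≤o∸n⇒m+n≤o _ a≤x (m⊓n≤m P r) , m≤o∸n⇒m+n≤o _ b≤y (m≤n+o⇒m∸n≤o r P r≤P+Q)
  where
  P Q : ℕ
  P = x ∸ a
  Q = y ∸ b
  x+y≡ : x + y ≡ (P + Q) + (a + b)
  x+y≡ = begin
    x + y               ≡⟨ cong₂ _+_ (sym (m∸n+n≡m a≤x)) (sym (m∸n+n≡m b≤y)) ⟩
    (P + a) + (Q + b)   ≡⟨ shuffle P a Q b ⟩
    (P + Q) + (a + b)   ∎
    where
    open ≡-Reasoning
    shuffle : ∀ m n o p → (m + n) + (o + p) ≡ (m + o) + (n + p)
    shuffle = solve-∀
  r≤P+Q : r ≤ P + Q
  r≤P+Q = +-cancelʳ-≤ (a + b) r (P + Q) (subst (r + (a + b) ≤_) x+y≡ budget)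

Budget : ℕ → ℕ → ℕ → ℕ → Set
Budget k ℓ e c = ∃ λ r → ℓ ≡ 2 * r + e × r + c ≤ k

within : ∀ b j d {s c k} → b + 2 * d ≤ b + 2 * j → b + 2 * j ≤ 2 * k ∸ s →
         b + 2 * d + s ≡ 2 * c → c ≤ k →
         Budget k (b + 2 * j) (b + 2 * d) c
within b j d {s} {c} {k} lower upper e+s≡2c c≤k with m≤n⇒∃[o]m+o≡n {m = d} {n = j} d≤j
  where
  d≤j : d ≤ j
  d≤j = *-cancelˡ-≤ 2 (+-cancelˡ-≤ b (2 * d) (2 * j) lower)
... | r , refl = r , shape b d r , *-cancelˡ-≤ 2 (subst (_≤ 2 * k) (sym twice) (m≤o∸n⇒m+n≤o _ s≤2k upper))
  where
  s≤2k : s ≤ 2 * k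
  s≤2k = ≤-trans (m≤n+m s (b + 2 * d)) (subst (_≤ 2 * k) (sym e+s≡2c) (*-monoʳ-≤ 2 c≤k))
  shape : ∀ b d r → b + 2 * (d + r) ≡ 2 * r + (b + 2 * d)
  shape = solve-∀
  twice : 2 * (r + c) ≡ b + 2 * (d + r) + s
  twice = begin
    2 * (r + c)               ≡⟨ *-distribˡ-+ 2 r c ⟩
    2 * r + 2 * c             ≡⟨ cong (2 * r +_) (sym e+s≡2c) ⟩
    2 * r + (b + 2 * d + s)   ≡⟨ regroup b d r s ⟩
    b + 2 * (d + r) + s       ∎
    where
    open ≡-Reasoning
    regroup : ∀ b d r s → 2 * r + (b + 2 * d + s) ≡ b + 2 * (d + r) + s
    regroup = solve-∀

-- the cost of p round trips in one block and q in the other, for a class of the first block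
weigh : ∀ p q {x y n E} → x ≤ 1 → y ≡ 0 → n ≤ E → p * x + q * y + n ≤ p + E
weigh p q {x} {n = n} {E} x≤1 refl n≤E = begin
  p * x + q * 0 + n   ≤⟨ +-monoˡ-≤ n (+-monoˡ-≤ (q * 0) (*-monoʳ-≤ p x≤1)) ⟩
  p * 1 + q * 0 + n   ≡⟨ cong₂ (λ a b → a + b + n) (*-identityʳ p) (*-zeroʳ q) ⟩
  p + 0 + n           ≡⟨ cong (_+ n) (+-identityʳ p) ⟩
  p + n               ≤⟨ +-monoʳ-≤ p n≤E ⟩
  p + E               ∎
  where open ≤-Reasoning

-- The classes of H(k) and the class path  B – A – X – Y

data Class : Set where
  A B X Y : Class

_≟ᶜ_ : DecidableEquality Class
A ≟ᶜ A = yes refl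
A ≟ᶜ B = no λ ()
A ≟ᶜ X = no λ ()
A ≟ᶜ Y = no λ ()
B ≟ᶜ A = no λ ()
B ≟ᶜ B = yes refl
B ≟ᶜ X = no λ ()
B ≟ᶜ Y = no λ ()
X ≟ᶜ A = no λ ()
X ≟ᶜ B = no λ ()
X ≟ᶜ X = yes refl
X ≟ᶜ Y = no λ ()
Y ≟ᶜ A = no λ ()
Y ≟ᶜ B = no λ ()
Y ≟ᶜ X = no λ ()
Y ≟ᶜ Y = yes refl

open Occurrences _≟ᶜ_

data Edge : Class → Class → Set where
  AB : Edge A B
  BA : Edge B A
  AX : Edge A X
  XA : Edge X A
  XY : Edge X Y
  YX : Edge Y X

-- A, B form the block ab and X, Y the block xy; each block induces a complete
-- bipartite graph, and zigzags run inside a block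
data Block : Set where
  ab xy : Block

block : Class → Block
block A = ab
block B = ab
block X = xy
block Y = xy

other : Block → Block
other ab = xy
other xy = ab

block-cases : ∀ β γ → γ ≡ β ⊎ γ ≡ other β
block-cases ab ab = inj₁ refl
block-cases ab xy = inj₂ refl
block-cases xy ab = inj₂ refl
block-cases xy xy = inj₁ refl

partner : Class → Class
partner A = B
partner B = A
partner X = Y
partner Y = X

partner-edges : ∀ c → Edge c (partner c) × Edge (partner c) c
partner-edges A = AB , BA
partner-edges B = BA , AB
partner-edges X = XY , YX
partner-edges Y = YX , XY

partner-≢ : ∀ c → partner c ≢ c
partner-≢ A ()
partner-≢ B ()
partner-≢ X ()
partner-≢ Y ()

block-partner : ∀ c → block (partner c) ≡ block c
block-partner A = refl
block-partner B = refl
block-partner X = refl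
block-partner Y = refl

other-≢ : ∀ β → β ≢ other β
other-≢ ab ()
other-≢ xy ()

excess : ∀ {n} → Block → Vec Class n → ℕ
excess ab w = count A w ⊔ count B w
excess xy w = count X w ⊔ count Y w

count≤excess : ∀ c {n} (w : Vec Class n) → count c w ≤ excess (block c) w
count≤excess A w = m≤m⊔n _ _
count≤excess B w = m≤n⊔m _ _
count≤excess X w = m≤m⊔n _ _
count≤excess Y w = m≤n⊔m _ _

round-trip : Class → Vec Class 2
round-trip s = partner s ∷ s ∷ []

round-trip-inside : ∀ c s → count c (round-trip s) ≤ 1
round-trip-inside c s = count-pair c (partner-≢ s)

round-trip-outside : ∀ {c s} → block c ≢ block s → count c (round-trip s) ≡ 0
round-trip-outside {c} {s} c∉ =
  count-absent ((λ c≡s̄ → c∉ (trans (cong block c≡s̄) (block-partner s)))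
              ∷ (λ c≡s → c∉ (cong block c≡s)) ∷ [])

-- s (s̄ s)ᵖ xs without its first letter: p round trips, then xs
zigzag : ∀ {n} (p : ℕ) → Class → Vec Class n → Vec Class (p * 2 + n)
zigzag zero    s xs = xs
zigzag (suc p) s xs = partner s ∷ s ∷ zigzag p s xs

zigzag-linked : ∀ {n} p s {xs : Vec Class n} → Linked Edge (s ∷ xs) → Linked Edge (s ∷ zigzag p s xs)
zigzag-linked zero    s linked = linked
zigzag-linked (suc p) s linked = proj₁ (partner-edges s) ∷ proj₂ (partner-edges s) ∷ zigzag-linked p s linked

zigzag-last : ∀ {n} p s (xs : Vec Class n) → last (s ∷ zigzag p s xs) ≡ last (s ∷ xs)
zigzag-last zero    s xs = refl
zigzag-last (suc p) s xs = zigzag-last p s xs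

zigzag-count : ∀ {n} c p s (xs : Vec Class n) → count c (zigzag p s xs) ≡ p * count c (round-trip s) + count c xs
zigzag-count c zero    s xs = refl
zigzag-count c (suc p) s xs = begin
  occ c (partner s) + (occ c s + count c (zigzag p s xs))
    ≡⟨ cong (λ z → occ c (partner s) + (occ c s + z)) (zigzag-count c p s xs) ⟩
  occ c (partner s) + (occ c s + (p * π + count c xs))
    ≡⟨ regroup (occ c (partner s)) (occ c s) p (count c xs) ⟩
  suc p * π + count c xs
    ∎
  where
  open ≡-Reasoning
  π : ℕ
  π = count c (round-trip s)
  regroup : ∀ o o′ p n → o + (o′ + (p * (o + (o′ + 0)) + n)) ≡ (o + (o′ + 0) + p * (o + (o′ + 0))) + n
  regroup = solve-∀

double-zigzag : ∀ {μ σ} (p q : ℕ) (s : Class) (M : Vec Class μ) (t : Class) (S : Vec Class σ) →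
                Vec Class (suc (p * 2 + (μ + suc (q * 2 + σ))))
double-zigzag p q s M t S = s ∷ zigzag p s (M ++ t ∷ zigzag q t S)

double-zigzag-linked : ∀ {μ σ} p q s (M : Vec Class μ) t (S : Vec Class σ) →
                       Linked Edge (s ∷ M ++ t ∷ []) → Linked Edge (t ∷ S) →
                       Linked Edge (double-zigzag p q s M t S)
double-zigzag-linked p q s M t S front back = zigzag-linked p s (linked-join (s ∷ M) front (zigzag-linked q t back))

double-zigzag-last : ∀ {μ σ} p q s (M : Vec Class μ) t (S : Vec Class σ) →
                     last (double-zigzag p q s M t S) ≡ last (t ∷ S)
double-zigzag-last p q s M t S = begin
  last (s ∷ zigzag p s (M ++ t ∷ zigzag q t S))   ≡⟨ zigzag-last p s _ ⟩
  last (s ∷ M ++ t ∷ zigzag q t S)                ≡⟨ last-++ s M _ ⟩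
  last (t ∷ zigzag q t S)                         ≡⟨ zigzag-last q t S ⟩
  last (t ∷ S)                                    ∎
  where open ≡-Reasoning

double-zigzag-count : ∀ {μ σ} c p q s (M : Vec Class μ) t (S : Vec Class σ) →
  count c (double-zigzag p q s M t S)
    ≡ p * count c (round-trip s) + q * count c (round-trip t) + count c (s ∷ M ++ t ∷ S)
double-zigzag-count c p q s M t S = begin
  occ c s + count c (zigzag p s (M ++ t ∷ zigzag q t S))
    ≡⟨ cong (occ c s +_) (zigzag-count c p s _) ⟩
  occ c s + (p * πs + count c (M ++ t ∷ zigzag q t S))
    ≡⟨ cong (λ z → occ c s + (p * πs + z)) (count-++ c M _) ⟩
  occ c s + (p * πs + (count c M + (occ c t + count c (zigzag q t S))))
    ≡⟨ cong (λ z → occ c s + (p * πs + (count c M + (occ c t + z)))) (zigzag-count c q t S) ⟩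
  occ c s + (p * πs + (count c M + (occ c t + (q * πt + count c S))))
    ≡⟨ regroup (occ c s) (p * πs) (count c M) (occ c t) (q * πt) (count c S) ⟩
  p * πs + q * πt + (occ c s + (count c M + (occ c t + count c S)))
    ≡⟨ cong (λ z → p * πs + q * πt + (occ c s + z)) (sym (count-++ c M (t ∷ S))) ⟩
  p * πs + q * πt + count c (s ∷ M ++ t ∷ S)
    ∎
  where
  open ≡-Reasoning
  πs πt : ℕ
  πs = count c (round-trip s)
  πt = count c (round-trip t)
  regroup : ∀ a b m d e n → a + (b + (m + (d + (e + n)))) ≡ b + e + (a + (m + (d + n)))
  regroup = solve-∀

-- The graph H(k) for k = 4 + d  (so that every class has at least two vertices)

module Graph (d : ℕ) where

  k : ℕ
  k = 4 + d

  blockSize : Block → ℕ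
  blockSize ab = ⌈ k /2⌉
  blockSize xy = ⌊ k /2⌋

  size : Class → ℕ
  size c = blockSize (block c)

  blockSize-sum : ∀ β → blockSize β + blockSize (other β) ≡ k
  blockSize-sum ab = trans (+-comm ⌈ k /2⌉ ⌊ k /2⌋) (⌊n/2⌋+⌈n/2⌉≡n k)
  blockSize-sum xy = ⌊n/2⌋+⌈n/2⌉≡n k

  2≤blockSize : ∀ β → 2 ≤ blockSize β
  2≤blockSize ab = s≤s (s≤s z≤n)
  2≤blockSize xy = s≤s (s≤s z≤n)

  size-nonZero : ∀ c → NonZero (size c)
  size-nonZero c = >-nonZero (≤-trans (s≤s z≤n) (2≤blockSize (block c)))

  vertex : (c : Class) → Fin (size c) → V k
  vertex A i = vA i
  vertex B i = vB i
  vertex X i = vX i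
  vertex Y i = vY i

  toΣ : V k → Σ Class (λ c → Fin (size c))
  toΣ (vA i) = A , i
  toΣ (vB i) = B , i
  toΣ (vX i) = X , i
  toΣ (vY i) = Y , i

  vertex-toΣ : ∀ u → uncurry vertex (toΣ u) ≡ u
  vertex-toΣ (vA i) = refl
  vertex-toΣ (vB i) = refl
  vertex-toΣ (vX i) = refl
  vertex-toΣ (vY i) = refl

  toΣ-vertex : ∀ c i → toΣ (vertex c i) ≡ (c , i)
  toΣ-vertex A i = refl
  toΣ-vertex B i = refl
  toΣ-vertex X i = refl
  toΣ-vertex Y i = refl

  classOf : V k → Class
  classOf u = proj₁ (toΣ u)

  index : V k → ℕ
  index u = toℕ (proj₂ (toΣ u))

  _≟ᵛ_ : DecidableEquality (V k)
  u ≟ᵛ v = map′ (λ eq → trans (sym (vertex-toΣ u)) (trans (cong (uncurry vertex) eq) (vertex-toΣ v)))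
                (cong toΣ) (≡-dec _≟ᶜ_ Fin._≟_ (toΣ u) (toΣ v))

  adj : ∀ {u v} → Edge (classOf u) (classOf v) → Adj u v
  adj {u} {v} e = subst₂ Adj (vertex-toΣ u) (vertex-toΣ v) (adj-vertex e)
    where
    adj-vertex : ∀ {c c′ i j} → Edge c c′ → Adj (vertex c i) (vertex c′ j)
    adj-vertex AB = tt
    adj-vertex BA = tt
    adj-vertex AX = tt
    adj-vertex XA = tt
    adj-vertex XY = tt
    adj-vertex YX = tt

  canonical : Class × ℕ → V k
  canonical (c , n) = vertex c ((n mod size c) {{size-nonZero c}})

  -- (c , n) is the n-th vertex of c without wrapping around
  InRange : Class × ℕ → Set
  InRange (c , n) = n < size c

  canonical-class : ∀ p → classOf (canonical p) ≡ proj₁ p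
  canonical-class (c , n) = cong proj₁ (toΣ-vertex c _)

  canonical-index : ∀ {c n} → n < size c → index (canonical (c , n)) ≡ n
  canonical-index {c} {n} n<size = begin
    index (canonical (c , n))   ≡⟨ cong (λ p → toℕ (proj₂ p)) (toΣ-vertex c _) ⟩
    toℕ (n mod size c)          ≡⟨ Fin.toℕ-fromℕ< _ ⟩
    n % size c                 ≡⟨ m<n⇒m%n≡m n<size ⟩
    n                           ∎
    where
    open ≡-Reasoning
    instance
      size-c-nonZero : NonZero (size c)
      size-c-nonZero = size-nonZero c

  canonical-injective : ∀ {p q} → InRange p → InRange q → canonical p ≡ canonical q → p ≡ q
  canonical-injective {c , m} {c′ , n} m∈ n∈ eq = cong₂ _,_
    (trans (sym (canonical-class (c , m))) (trans (cong classOf eq) (canonical-class (c′ , n))))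
    (trans (sym (canonical-index {c} m∈)) (trans (cong index eq) (canonical-index {c′} n∈)))

  open Swap _≟ᵛ_

  -- A labelling of numbered occurrences by vertices: the canonical one, followed by
  -- two transpositions that move (s , 0) to u and (e , N) to v.
  module Labelling (u v : V k) (s e : Class) (N : ℕ) (u∈s : classOf u ≡ s) (v∈e : classOf v ≡ e) where

    first : V k → V k
    first = swap (canonical (s , 0)) u

    second : V k → V k
    second = swap (first (canonical (e , N))) v

    label : Class × ℕ → V k
    label p = second (first (canonical p))

    first-class : ∀ x → classOf (first x) ≡ classOf x
    first-class = swap-preserves classOf (trans (canonical-class (s , 0)) (sym u∈s))

    second-class : ∀ x → classOf (second x) ≡ classOf x
    second-class = swap-preserves classOf
      (trans (first-class (canonical (e , N))) (trans (canonical-class (e , N)) (sym v∈e)))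

    label-class : ∀ p → classOf (label p) ≡ proj₁ p
    label-class p = trans (second-class (first (canonical p))) (trans (first-class (canonical p)) (canonical-class p))

    label-injective : ∀ {p q} → InRange p → InRange q → label p ≡ label q → p ≡ q
    label-injective p∈ q∈ eq =
      canonical-injective p∈ q∈ (swap-injective (canonical (s , 0)) u (swap-injective (first (canonical (e , N))) v eq))

    label-end : label (e , N) ≡ v
    label-end = swap-left (first (canonical (e , N))) v

    label-start : InRange (s , 0) → InRange (e , N) → (s , 0) ≢ (e , N) → u ≢ v → label (s , 0) ≡ u
    label-start s∈ e∈ distinct u≢v =
      trans (cong second (swap-left (canonical (s , 0)) u)) (swap-other u≢first-e u≢v)
      where
      u≢first-e : u ≢ first (canonical (e , N))
      u≢first-e eq = distinct (canonical-injective s∈ e∈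
        (swap-injective (canonical (s , 0)) u (trans (swap-left (canonical (s , 0)) u) eq)))

  word-path : ∀ {ℓ} (w : Vec Class (suc ℓ)) → 0 < ℓ → Linked Edge w → (∀ c → count c w ≤ size c) →
              ∀ {u v} → classOf u ≡ head w → classOf v ≡ last w → u ≢ v → PathOfLength ℓ u v
  word-path {ℓ} w@(s ∷ _) (s≤s _) linked fits {u} {v} u∈s v∈last u≢v =
    path (map label ns) (label-start (All.head in-range) (All-last in-range) start≢end u≢v)
         (trans (last-map label ns) label-end) walk distinct
    where
    ns : Vec (Class × ℕ) (suc ℓ)
    ns = number w
    end : Class × ℕ
    end = last ns
    last-letter : proj₁ end ≡ last w
    last-letter = trans (sym (last-map proj₁ ns)) (cong last (number-letters w))
    open Labelling u v s (proj₁ end) (proj₂ end) u∈s (trans v∈last (sym last-letter))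

    in-range : All InRange ns
    in-range = All.map (λ {p} below → <-≤-trans below (fits (proj₁ p))) (number-bound w)

    start≢end : (s , 0) ≢ end
    start≢end = All-last (AllPairs.head (number-unique w))

    walk : Linked Adj (map label ns)
    walk = Linked.map⁺ (Linked.map step (Linked.map⁻ (subst (Linked Edge) (sym (number-letters w)) linked)))
      where
      step : ∀ {p q} → Edge (proj₁ p) (proj₁ q) → Adj (label p) (label q)
      step {p} {q} e = adj (subst₂ Edge (sym (label-class p)) (sym (label-class q)) e)

    distinct : Unique (map label ns)
    distinct = unique-map-on label-injective in-range (number-unique w)

  Family : ℕ → ℕ → V k → V k → Set
  Family e c u v = ∀ r → r + c ≤ k → PathOfLength {k} (2 * r + e) u v

  -- A base word  s M t S  with s in the block β and t in the other block yields a
  -- family: insert p round trips after s and q after t, where the budget r = p + q is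
  -- split so that every class still fits.  The excesses of the base word in the two
  -- blocks are the vertices of each class already used by the base word.
  zigzag-family : ∀ {μ σ} (β : Block) (s : Class) (M : Vec Class μ) (t : Class) (S : Vec Class σ) →
    let base = s ∷ M ++ t ∷ S in
    block s ≡ β → block t ≡ other β → Linked Edge (s ∷ M ++ t ∷ []) → Linked Edge (t ∷ S) →
    excess β base ≤ 2 → excess (other β) base ≤ 2 →
    ∀ {u v} → classOf u ≡ s → classOf v ≡ last (t ∷ S) → u ≢ v →
    Family (μ + suc σ) (excess β base + excess (other β) base) u v
  zigzag-family {μ} {σ} β s M t S s∈β t∈β′ front back E≤2 E′≤2 {u} {v} u∈s v∈e u≢v r budget
    with split {r} (≤-trans E≤2 (2≤blockSize β)) (≤-trans E′≤2 (2≤blockSize (other β)))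
               (≤-trans budget (≤-reflexive (sym (blockSize-sum β))))
  ... | p , q , refl , p-fits , q-fits =
    subst (λ ℓ → PathOfLength ℓ u v) (length-eq p q μ σ)
      (word-path word positive (double-zigzag-linked p q s M t S front back) fits
                 u∈s (trans v∈e (sym (double-zigzag-last p q s M t S))) u≢v)
    where
    base : Vec Class (suc (μ + suc σ))
    base = s ∷ M ++ t ∷ S
    word : Vec Class (suc (p * 2 + (μ + suc (q * 2 + σ))))
    word = double-zigzag p q s M t S

    length-eq : ∀ p q μ σ → p * 2 + (μ + suc (q * 2 + σ)) ≡ 2 * (p + q) + (μ + suc σ)
    length-eq = solve-∀

    positive : 0 < p * 2 + (μ + suc (q * 2 + σ))
    positive = ≤-trans (s≤s z≤n) (≤-trans (m≤n+m _ μ) (m≤n+m _ (p * 2)))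

    -- a class of the block β gains p occurrences, a class of the other block q
    fits : ∀ c → count c word ≤ size c
    fits c with block-cases β (block c)
    ... | inj₁ c∈β = begin
      count c word                                                      ≡⟨ double-zigzag-count c p q s M t S ⟩
      p * count c (round-trip s) + q * count c (round-trip t) + count c base
        ≤⟨ weigh p q (round-trip-inside c s) (round-trip-outside c∉t) base≤E ⟩
      p + excess β base                                                 ≤⟨ p-fits ⟩
      blockSize β                                                       ≡⟨ cong blockSize (sym c∈β) ⟩
      size c                                                            ∎
      where
      open ≤-Reasoning
      c∉t : block c ≢ block t
      c∉t c∈t = other-≢ β (trans (sym c∈β) (trans c∈t t∈β′))
      base≤E : count c base ≤ excess β base
      base≤E = subst (λ γ → count c base ≤ excess γ base) c∈β (count≤excess c base)
    ... | inj₂ c∈β′ = begin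
      count c word                                                      ≡⟨ double-zigzag-count c p q s M t S ⟩
      p * count c (round-trip s) + q * count c (round-trip t) + count c base
        ≡⟨ cong (_+ count c base) (+-comm (p * count c (round-trip s)) _) ⟩
      q * count c (round-trip t) + p * count c (round-trip s) + count c base
        ≤⟨ weigh q p (round-trip-inside c t) (round-trip-outside c∉s) base≤E ⟩
      q + excess (other β) base                                         ≤⟨ q-fits ⟩
      blockSize (other β)                                               ≡⟨ cong blockSize (sym c∈β′) ⟩
      size c                                                            ∎
      where
      open ≤-Reasoning
      c∉s : block c ≢ block s
      c∉s c∈s = other-≢ β (sym (trans (sym c∈β′) (trans c∈s s∈β)))
      base≤E : count c base ≤ excess (other β) base
      base≤E = subst (λ γ → count c base ≤ excess γ base) c∈β′ (count≤excess c base)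

  prepend : ∀ {e c u v} → PathOfLength {k} e u v → Family (2 + e) (suc c) u v → Family e c u v
  prepend shortest family zero    _ = shortest
  prepend {e} {c} {u} {v} shortest family (suc r) budget =
    subst (λ ℓ → PathOfLength ℓ u v) (shift r e) (family r (subst (_≤ k) (sym (+-suc r c)) budget))
    where
    shift : ∀ r e → 2 * r + (2 + e) ≡ 2 * suc r + e
    shift = solve-∀

  at : ∀ {ℓ e c u v} → Budget k ℓ e c → Family e c u v → PathOfLength ℓ u v
  at (r , refl , budget) family = family r budget

  -- a (b a)ᵖ x (y x)ᵠ
  A⇝X : ∀ {a x} → Family 1 2 (vA a) (vX x)
  A⇝X = zigzag-family ab A [] X [] refl refl (AX ∷ [-]) [-] (s≤s z≤n) (s≤s z≤n) refl refl λ ()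

  -- b (a b)ᵖ a x (y x)ᵠ a
  B⇝A : ∀ {a b} → Family 3 3 (vB b) (vA a)
  B⇝A = zigzag-family ab B (A ∷ []) X (A ∷ []) refl refl (BA ∷ AX ∷ [-]) (XA ∷ [-])
                      (s≤s (s≤s z≤n)) (s≤s z≤n) refl refl λ ()

  -- y (x y)ᵖ x a (b a)ᵠ x
  Y⇝X : ∀ {x y} → Family 3 3 (vY y) (vX x)
  Y⇝X = zigzag-family xy Y (X ∷ []) A (X ∷ []) refl refl (YX ∷ XA ∷ [-]) (AX ∷ [-])
                      (s≤s (s≤s z≤n)) (s≤s z≤n) refl refl λ ()

  -- b (a b)ᵖ a x (y x)ᵠ y
  B⇝Y : ∀ {b y} → Family 3 2 (vB b) (vY y)
  B⇝Y = zigzag-family ab B (A ∷ []) X (Y ∷ []) refl refl (BA ∷ AX ∷ [-]) (XY ∷ [-])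
                      (s≤s z≤n) (s≤s z≤n) refl refl λ ()

  -- a (b a)ᵖ x (y x)ᵠ a′
  A⇝A′ : ∀ {a a′} → a ≢ a′ → Family 2 3 (vA a) (vA a′)
  A⇝A′ a≢a′ = zigzag-family ab A [] X (A ∷ []) refl refl (AX ∷ [-]) (XA ∷ [-])
                            (s≤s (s≤s z≤n)) (s≤s z≤n) refl refl λ { refl → a≢a′ refl }

  -- x (y x)ᵖ a (b a)ᵠ x′
  X⇝X′ : ∀ {x x′} → x ≢ x′ → Family 2 3 (vX x) (vX x′)
  X⇝X′ x≢x′ = zigzag-family xy X [] A (X ∷ []) refl refl (XA ∷ [-]) (AX ∷ [-])
                            (s≤s (s≤s z≤n)) (s≤s z≤n) refl refl λ { refl → x≢x′ refl }

  -- b a b′, and b (a b)ᵖ a x (y x)ᵠ a b′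
  B⇝B′ : ∀ {b b′} → b ≢ b′ → Family 2 2 (vB b) (vB b′)
  B⇝B′ b≢b′ = prepend
    (word-path (B ∷ A ∷ B ∷ []) (s≤s z≤n) (BA ∷ AB ∷ [-])
               (λ { A → s≤s z≤n ; B → 2≤blockSize ab ; X → z≤n ; Y → z≤n }) refl refl λ { refl → b≢b′ refl })
    (zigzag-family ab B (A ∷ []) X (A ∷ B ∷ []) refl refl (BA ∷ AX ∷ [-]) (XA ∷ AB ∷ [-])
                   (s≤s (s≤s z≤n)) (s≤s z≤n) refl refl λ { refl → b≢b′ refl })

  -- y x y′, and y (x y)ᵖ x a (b a)ᵠ x y′
  Y⇝Y′ : ∀ {y y′} → y ≢ y′ → Family 2 2 (vY y) (vY y′)
  Y⇝Y′ y≢y′ = prepend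
    (word-path (Y ∷ X ∷ Y ∷ []) (s≤s z≤n) (YX ∷ XY ∷ [-])
               (λ { A → z≤n ; B → z≤n ; X → s≤s z≤n ; Y → 2≤blockSize xy }) refl refl λ { refl → y≢y′ refl })
    (zigzag-family xy Y (X ∷ []) A (X ∷ Y ∷ []) refl refl (YX ∷ XA ∷ [-]) (AX ∷ XY ∷ [-])
                   (s≤s (s≤s z≤n)) (s≤s z≤n) refl refl λ { refl → y≢y′ refl })

  -- b (a b)ᵖ a x (y x)ᵠ
  B⇝X : ∀ {b x} → Family 2 2 (vB b) (vX x)
  B⇝X = zigzag-family ab B (A ∷ []) X [] refl refl (BA ∷ AX ∷ [-]) [-] (s≤s z≤n) (s≤s z≤n) refl refl λ ()

  -- y (x y)ᵖ x a (b a)ᵠ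
  Y⇝A : ∀ {a y} → Family 2 2 (vY y) (vA a)
  Y⇝A = zigzag-family xy Y (X ∷ []) A [] refl refl (YX ∷ XA ∷ [-]) [-] (s≤s z≤n) (s≤s z≤n) refl refl λ ()

lemma2p1 : (k : ℕ) → 5 ≤ k →
    (α₁ α₂ β₁ β₂ : ℕ) →
    Odd α₁ → 3 ≤ α₁ → α₁ ≤ 2 * k ∸ 3 →
    Odd α₂ → 3 ≤ α₂ → α₂ ≤ 2 * k ∸ 1 →
    Even β₁ → 2 ≤ β₁ → β₁ ≤ 2 * k ∸ 4 →
    Even β₂ → 2 ≤ β₂ → β₂ ≤ 2 * k ∸ 2 →
    ∀ a a' b b' x x' y y' → a ≢ a' → b ≢ b' → x ≢ x' → y ≢ y' →
    (PathOfLength {k} α₁ (vA a) (vX x) × PathOfLength {k} α₁ (vB b) (vA a) × PathOfLength {k} α₁ (vY y) (vX x))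
    × PathOfLength {k} α₂ (vB b) (vY y)
    × (PathOfLength {k} β₁ (vA a) (vA a') × PathOfLength {k} β₁ (vX x) (vX x'))
    × (PathOfLength {k} β₂ (vB b) (vB b') × PathOfLength {k} β₂ (vY y) (vY y')
    × PathOfLength {k} β₂ (vB b) (vX x) × PathOfLength {k} β₂ (vY y) (vA a))
lemma2p1 (suc (suc (suc (suc d)))) (s≤s (s≤s (s≤s (s≤s _)))) _ _ _ _
         (i₁ , refl) 3≤α₁ α₁≤ (i₂ , refl) 3≤α₂ α₂≤ (j₁ , refl) 2≤β₁ β₁≤ (j₂ , refl) 2≤β₂ β₂≤
         a a′ b b′ x x′ y y′ a≢a′ b≢b′ x≢x′ y≢y′ =
  (at α₁=2r+1 A⇝X , at α₁=2r+3 B⇝A , at α₁=2r+3 Y⇝X) ,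
  at α₂=2r+3 B⇝Y ,
  (at β₁=2r+2 (A⇝A′ a≢a′) , at β₁=2r+2 (X⇝X′ x≢x′)) ,
  (at β₂=2r+2 (B⇝B′ b≢b′) , at β₂=2r+2 (Y⇝Y′ y≢y′) , at β₂=2r+2 B⇝X , at β₂=2r+2 Y⇝A)
  where
  open Graph d
  2≤k : 2 ≤ k
  2≤k = s≤s (s≤s z≤n)
  3≤k : 3 ≤ k
  3≤k = s≤s (s≤s (s≤s z≤n))
  α₁=2r+1 : Budget k (suc (2 * i₁)) 1 2
  α₁=2r+1 = within 1 i₁ 0 (s≤s z≤n) α₁≤ refl 2≤k
  α₁=2r+3 : Budget k (suc (2 * i₁)) 3 3
  α₁=2r+3 = within 1 i₁ 1 3≤α₁ α₁≤ refl 3≤k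
  α₂=2r+3 : Budget k (suc (2 * i₂)) 3 2
  α₂=2r+3 = within 1 i₂ 1 3≤α₂ α₂≤ refl 2≤k
  β₁=2r+2 : Budget k (2 * j₁) 2 3
  β₁=2r+2 = within 0 j₁ 1 2≤β₁ β₁≤ refl 3≤k
  β₂=2r+2 : Budget k (2 * j₂) 2 2
  β₂=2r+2 = within 0 j₂ 1 2≤β₂ β₂≤ refl 2≤k
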